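{- Let $k\ge 4$ and let $G_k$ be the graph defined below (for $\ell=2$). Then the only edge of $G_k$ from a node not in $B_1$ to a node of $B_1$ is the blue edge (of weight $-1$) from $II_t^k$ to $I_b^k$.
   Context: The pruning function $\operatorname{P}_{2}:\mathbb{Z}_{>0}\to\mathbb{Z}_{\geq 0}$: write $m$ in binary, padded on the left with zeros as needed, let $z$ be the position (position $0$ = least significant bit) of the second zero bit counted from the right, let $q = 2^{z}\lfloor m/2^{z}\rfloor$, and set $\operatorname{P}_2(m)=\max(q-1,0)$. For an integer $k\ge 2$, $G_k$ is the directed graph with node set $\{0\}\cup\{2^{k-1}-1,\ldots,2^k-1\}$ and edges: for each $m$ with $2^{k-1}-1\le m<2^k-1$, a "blue" edge from $m$ to $m+1$ (weight $-1$) and a "red" edge from $\operatorname{P}_2(m)$ to $m$ (weight $+1$). For $k\ge 4$ set $I_t^k=2^k-1$, $I_b^k=2^k-2^{k-2}-1$, $II_t^k=2^k-2^{k-2}-2$. $B_1$ of $G_k$ is the induced subgraph of $G_k$ on $\{0\}\cup\{I_b^k,\ldots,I_t^k\}$. -}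

module Defs where

open import Data.Nat using (ℕ; zero; suc; _+_; _*_; _∸_; _^_; _≤_; _<_; _⊔_)
open import Data.Nat.Properties using (m^n≢0)
open import Data.Nat.DivMod using (_/_; _%_)
open import Data.Product using (_×_)
open import Data.Sum using (_⊎_)
open import Relation.Binary.PropositionalEquality using (_≡_)

-- Position (0 = least significant) of the `need`-th zero bit (need ≥ 1) of m,
-- scanning from the right; m is implicitly padded with infinitely many zeros.
-- The first argument is fuel; m + 2 steps always suffice.
zeroPosGo : ℕ → ℕ → ℕ → ℕ
zeroPosGo zero m need = zero
zeroPosGo (suc f) m need with m % 2
... | zero with need
...   | suc zero = zero
...   | _ = suc (zeroPosGo f (m / 2) (need ∸ 1))
zeroPosGo (suc f) m need | suc _ = suc (zeroPosGo f (m / 2) need)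

secondZeroPos : ℕ → ℕ
secondZeroPos m = zeroPosGo (m + 2) m 2

P₂ : ℕ → ℕ
P₂ m = (2 ^ z) * ((m / (2 ^ z)) {{m^n≢0 2 z}}) ∸ 1
  where z = secondZeroPos m

-- Edge colours: blue has weight -1, red has weight +1.
data Colour : Set where
  blue red : Colour

IsNode : ℕ → ℕ → Set
IsNode k v = v ≡ 0 ⊎ (2 ^ (k ∸ 1) ∸ 1 ≤ v × v ≤ 2 ^ k ∸ 1)

data IsEdge (k : ℕ) : Colour → ℕ → ℕ → Set where
  blueEdge : ∀ m → 2 ^ (k ∸ 1) ∸ 1 ≤ m → m < 2 ^ k ∸ 1 → IsEdge k blue m (suc m)
  redEdge  : ∀ m → 2 ^ (k ∸ 1) ∸ 1 ≤ m → m < 2 ^ k ∸ 1 → IsEdge k red (P₂ m) m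

It : ℕ → ℕ
It k = 2 ^ k ∸ 1

Ib : ℕ → ℕ
Ib k = 2 ^ k ∸ 2 ^ (k ∸ 2) ∸ 1

IIt : ℕ → ℕ
IIt k = 2 ^ k ∸ 2 ^ (k ∸ 2) ∸ 2

InB₁ : ℕ → ℕ → Set
InB₁ k v = v ≡ 0 ⊎ (Ib k ≤ v × v ≤ It k)

-- Write k = p + 2 and P = 2^p, so that B₁ = {0} ∪ [3P - 1, 4P - 1] and II_t = 3P - 2
-- sits just below it.  A blue edge m → m + 1 can only enter B₁ at its lowest node,
-- which forces m = II_t.  A red edge P₂(m) → m never enters, because P₂ maps B₁ into
-- itself: for m ∈ [3P - 1, 4P) let z be its second zero bit.  Bit p + 1 of m is 1, so
-- z ≠ p + 1; if z > p + 1, rounding m down to a multiple of 2^z gives 0; if z ≤ p, then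
-- m has a zero bit below p, whereas 3P - 1 has none, so m ≥ 3P, and rounding down to a
-- multiple of 2^z, which divides 3P, stays ≥ 3P.
module Submission where

open import Defs
open import Data.Nat
open import Data.Nat.Properties
open import Data.Nat.DivMod
open import Data.Nat.Divisibility using (n∣m*n)
open import Data.Nat.Tactic.RingSolver using (solve-∀)
open import Data.Product using (_×_; _,_; proj₁; proj₂; ∃-syntax)
open import Data.Sum using (_⊎_; inj₁; inj₂)
open import Relation.Nullary using (¬_; contradiction)
open import Relation.Binary.PropositionalEquality
open import Relation.Binary.Definitions using (tri<; tri≈; tri>)

infixl 7 _>>_

_>>_ : ℕ → ℕ → ℕ
m >> j = (m / 2 ^ j) {{m^n≢0 2 j}}

bit : ℕ → ℕ → ℕ
bit m j = m >> j % 2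

bit-zero : ∀ m → bit m 0 ≡ m % 2
bit-zero m = cong (_% 2) (n/1≡n m)

bit-suc : ∀ m j → bit m (suc j) ≡ bit (m / 2) j
bit-suc m j = cong (_% 2) (sym (m/n/o≡m/[n*o] m 2 (2 ^ j) {{_}} {{m^n≢0 2 j}} {{m^n≢0 2 (suc j)}}))

m/2<m-odd : ∀ m {r} → m % 2 ≡ suc r → m / 2 < m
m/2<m-odd (suc m) _ = m/n<m (suc m) 2 (s≤s (s≤s z≤n))

ZeroBitBelow : ℕ → ℕ → Set
ZeroBitBelow m z = ∃[ j ] (j < z × bit m j ≡ 0)

zeroPosGo-spec : ∀ f m n → suc n + m ≤ f →
  bit m (zeroPosGo f m (suc n)) ≡ 0 × (1 ≤ n → ZeroBitBelow m (zeroPosGo f m (suc n)))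
zeroPosGo-spec (suc f) m n fuel with m % 2 in m%2
zeroPosGo-spec (suc f) m zero fuel | zero = trans (bit-zero m) m%2 , λ ()
zeroPosGo-spec (suc f) m (suc n) fuel | zero =
  trans (bit-suc m z) zeroAt-z , λ _ → 0 , z<s , trans (bit-zero m) m%2
  where
  z = zeroPosGo f (m / 2) (suc n)
  zeroAt-z = proj₁ (zeroPosGo-spec f (m / 2) n
               (≤-trans (+-monoʳ-≤ (suc n) (m/n≤m m 2)) (s≤s⁻¹ fuel)))
zeroPosGo-spec (suc f) m n fuel | suc _ =
  trans (bit-suc m z) zeroAt-z , λ 1≤n → shift (zeroBelow-z 1≤n)
  where
  z = zeroPosGo f (m / 2) (suc n)
  IH = zeroPosGo-spec f (m / 2) n (s≤s⁻¹ (≤-trans (+-monoʳ-< (suc n) (m/2<m-odd m m%2)) fuel))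
  zeroAt-z = proj₁ IH
  zeroBelow-z = proj₂ IH
  shift : ZeroBitBelow (m / 2) z → ZeroBitBelow m (suc z)
  shift (j , j<z , bit≡0) = suc j , s<s j<z , trans (bit-suc m j) bit≡0

secondZeroPos-spec : ∀ m → bit m (secondZeroPos m) ≡ 0 × ZeroBitBelow m (secondZeroPos m)
secondZeroPos-spec m with zeroPosGo-spec (m + 2) m 1 (≤-reflexive (+-comm 2 m))
... | zeroAt , zeroBelow = zeroAt , zeroBelow ≤-refl

bit-leading : ∀ m j → 2 ^ j ≤ m → m < 2 * 2 ^ j → bit m j ≡ 1
bit-leading m j lo hi = cong (_% 2) (≤-antisym (s≤s⁻¹ (m<n*o⇒m/o<n {{m^n≢0 2 j}} hi)) (m≥n⇒m/n>0 {{m^n≢0 2 j}} lo))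

[m*n∸1]/n≡m∸1 : ∀ m n .{{_ : NonZero m}} .{{_ : NonZero n}} → (m * n ∸ 1) / n ≡ m ∸ 1
[m*n∸1]/n≡m∸1 (suc m) n = begin
  (n + m * n ∸ 1) / n    ≡⟨ /-congˡ (+-∸-comm (m * n) (>-nonZero⁻¹ n)) ⟩
  (n ∸ 1 + m * n) / n    ≡⟨ +-distrib-/-∣ʳ (n ∸ 1) (n∣m*n m) ⟩
  (n ∸ 1) / n + m * n / n ≡⟨ cong₂ _+_ (m<n⇒m/n≡0 (∸-monoˡ-< ≤-refl (>-nonZero⁻¹ n))) (m*n/n≡m m n) ⟩
  m                      ∎
  where open ≡-Reasoning

[2*n∸1]%2≡1 : ∀ n .{{_ : NonZero n}} → (2 * n ∸ 1) % 2 ≡ 1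
[2*n∸1]%2≡1 (suc n) = trans (cong (_% 2) (expand n)) ([m+kn]%n≡m%n 1 n 2)
  where
  expand : ∀ n → n + suc (n + 0) ≡ 1 + n * 2
  expand = solve-∀

bit-pred-multiple : ∀ c z j .{{_ : NonZero c}} → j < z → bit (c * 2 ^ z ∸ 1) j ≡ 1
bit-pred-multiple c z j {{c≢0}} j<z with m≤n⇒∃[o]m+o≡n j<z
... | d , refl = begin
  (c * 2 ^ (suc j + d) ∸ 1) >> j % 2  ≡⟨ cong (λ x → (c * x ∸ 1) >> j % 2) (^-distribˡ-+-* 2 (suc j) d) ⟩
  (c * (2 * 2 ^ j * 2 ^ d) ∸ 1) >> j % 2 ≡⟨ cong (λ x → (x ∸ 1) >> j % 2) (regroup c (2 ^ j) (2 ^ d)) ⟩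
  ((2 * c′) * 2 ^ j ∸ 1) >> j % 2     ≡⟨ cong (_% 2) ([m*n∸1]/n≡m∸1 (2 * c′) (2 ^ j) {{2c′≢0}} {{m^n≢0 2 j}}) ⟩
  (2 * c′ ∸ 1) % 2                    ≡⟨ [2*n∸1]%2≡1 c′ {{c′≢0}} ⟩
  1                                   ∎
  where
  open ≡-Reasoning
  c′ : ℕ
  c′ = c * 2 ^ d
  c′≢0 : NonZero c′
  c′≢0 = m*n≢0 c (2 ^ d) {{c≢0}} {{m^n≢0 2 d}}
  2c′≢0 : NonZero (2 * c′)
  2c′≢0 = m*n≢0 2 c′ {{_}} {{c′≢0}}
  regroup : ∀ c a b → c * (2 * a * b) ≡ 2 * (c * b) * a
  regroup = solve-∀

2*n≤3*n∸1 : ∀ n .{{_ : NonZero n}} → 2 * n ≤ 3 * n ∸ 1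
2*n≤3*n∸1 (suc n) = subst (2 * suc n ≤_) (sym (split n)) (m≤m+n (2 * suc n) n)
  where
  split : ∀ n → n + suc (n + suc (n + 0)) ≡ 2 * suc n + n
  split = solve-∀

2*[2*n]≡3*n+n : ∀ n → 2 * (2 * n) ≡ 3 * n + n
2*[2*n]≡3*n+n = solve-∀

2*[2*n]∸n≡3*n : ∀ n → 2 * (2 * n) ∸ n ≡ 3 * n
2*[2*n]∸n≡3*n n = trans (cong (_∸ n) (2*[2*n]≡3*n+n n)) (m+n∸n≡m (3 * n) n)

-- P₂ m unfolds definitionally to roundDown (secondZeroPos m) m ∸ 1.
roundDown : ℕ → ℕ → ℕ
roundDown z m = 2 ^ z * (m >> z)

roundDown[z,m]≤m : ∀ z m → roundDown z m ≤ m
roundDown[z,m]≤m z m = subst (_≤ m) (*-comm (m >> z) (2 ^ z)) (m/n*n≤m m (2 ^ z) {{m^n≢0 2 z}})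

m<2^z⇒roundDown≡0 : ∀ z m → m < 2 ^ z → roundDown z m ≡ 0
m<2^z⇒roundDown≡0 z m m<2^z = trans (cong (2 ^ z *_) (m<n⇒m/n≡0 {{m^n≢0 2 z}} m<2^z)) (*-zeroʳ (2 ^ z))

multiple≤roundDown : ∀ c z m → c * 2 ^ z ≤ m → c * 2 ^ z ≤ roundDown z m
multiple≤roundDown c z m c2^z≤m = begin
  c * 2 ^ z   ≡⟨ *-comm c (2 ^ z) ⟩
  2 ^ z * c   ≤⟨ *-monoʳ-≤ (2 ^ z) c≤m>>z ⟩
  2 ^ z * (m >> z) ∎
  where
  open ≤-Reasoning
  c≤m>>z : c ≤ m >> z
  c≤m>>z = subst (_≤ m >> z) (m*n/n≡m c (2 ^ z) {{m^n≢0 2 z}}) (/-monoˡ-≤ (2 ^ z) {{m^n≢0 2 z}} c2^z≤m)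

P₂[m]≤m : ∀ m → P₂ m ≤ m
P₂[m]≤m m = ≤-trans (m∸n≤m _ 1) (roundDown[z,m]≤m (secondZeroPos m) m)

roundDown-topQuarter : ∀ p m z → 3 * 2 ^ p ∸ 1 ≤ m → m < 2 * (2 * 2 ^ p) →
  bit m z ≡ 0 → ZeroBitBelow m z → roundDown z m ≡ 0 ⊎ 3 * 2 ^ p ≤ roundDown z m
roundDown-topQuarter p m z lo hi zeroAt (j , j<z , zeroAt-j) with <-cmp z (suc p)
... | tri> _ _ p+1<z = inj₁ (m<2^z⇒roundDown≡0 z m (<-≤-trans hi (^-monoʳ-≤ 2 p+1<z)))
... | tri≈ _ refl _ =
  contradiction (trans (sym zeroAt) (bit-leading m (suc p) (≤-trans (2*n≤3*n∸1 (2 ^ p) {{m^n≢0 2 p}}) lo) hi)) λ ()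
... | tri< z≤p _ _ with m≤n⇒m<n∨m≡n lo
...   | inj₂ refl =
  contradiction (trans (sym zeroAt-j) (bit-pred-multiple 3 p j (<-≤-trans j<z (s≤s⁻¹ z≤p)))) λ ()
...   | inj₁ 3P∸1<m with m≤n⇒∃[o]m+o≡n (s≤s⁻¹ z≤p)
...     | d , refl = inj₂ (subst (_≤ roundDown z m) (sym regroup)
                             (multiple≤roundDown (3 * 2 ^ d) z m (subst (_≤ m) regroup 3P≤m)))
  where
  3P≤m : 3 * 2 ^ (z + d) ≤ m
  3P≤m = subst (_≤ m) (suc-pred (3 * 2 ^ (z + d)) {{m*n≢0 3 (2 ^ (z + d)) {{_}} {{m^n≢0 2 (z + d)}}}}) 3P∸1<m
  rearrange : ∀ a b → 3 * (a * b) ≡ 3 * b * a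
  rearrange = solve-∀
  regroup : 3 * 2 ^ (z + d) ≡ 3 * 2 ^ d * 2 ^ z
  regroup = trans (cong (3 *_) (^-distribˡ-+-* 2 z d)) (rearrange (2 ^ z) (2 ^ d))

P₂-topQuarter : ∀ p m → 3 * 2 ^ p ∸ 1 ≤ m → m < 2 * (2 * 2 ^ p) → P₂ m ≡ 0 ⊎ 3 * 2 ^ p ∸ 1 ≤ P₂ m
P₂-topQuarter p m lo hi with secondZeroPos-spec m
... | zeroAt , zeroBelow with roundDown-topQuarter p m (secondZeroPos m) lo hi zeroAt zeroBelow
...   | inj₁ rounded≡0 = inj₁ (cong (_∸ 1) rounded≡0)
...   | inj₂ 3P≤rounded = inj₂ (∸-monoˡ-≤ 1 3P≤rounded)

module _ (p : ℕ) where
  private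
    k : ℕ
    k = 2 + p

    P : ℕ
    P = 2 ^ p

    1≤P : 1 ≤ P
    1≤P = m^n>0 2 p

  Ib≡3P∸1 : Ib k ≡ 3 * P ∸ 1
  Ib≡3P∸1 = cong (_∸ 1) (2*[2*n]∸n≡3*n P)

  Ib≡suc-IIt : Ib k ≡ suc (IIt k)
  Ib≡suc-IIt = begin
    Ib k              ≡⟨ Ib≡3P∸1 ⟩
    suc (3 * P) ∸ 2   ≡⟨ +-∸-assoc 1 {3 * P} {2} (≤-trans (s≤s (s≤s z≤n)) (*-monoʳ-≤ 3 1≤P)) ⟩
    suc (3 * P ∸ 2)   ≡⟨ cong (λ x → suc (x ∸ 2)) (2*[2*n]∸n≡3*n P) ⟨
    suc (IIt k)       ∎
    where open ≡-Reasoning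

  Ib≤It : Ib k ≤ It k
  Ib≤It = subst (_≤ It k) (sym Ib≡3P∸1)
            (∸-monoˡ-≤ 1 (subst (3 * P ≤_) (sym (2*[2*n]≡3*n+n P)) (m≤m+n (3 * P) P)))

  IIt<It : IIt k < It k
  IIt<It = subst (_≤ It k) Ib≡suc-IIt Ib≤It

  2P∸1≤IIt : 2 * P ∸ 1 ≤ IIt k
  2P∸1≤IIt = ∸-monoˡ-≤ 1 (subst (2 * P ≤_) (trans (sym Ib≡3P∸1) Ib≡suc-IIt) (2*n≤3*n∸1 P {{m^n≢0 2 p}}))

  1≤2P∸1 : 1 ≤ 2 * P ∸ 1
  1≤2P∸1 = ∸-monoˡ-≤ 1 (*-monoʳ-≤ 2 1≤P)

  IIt-isNode : IsNode k (IIt k)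
  IIt-isNode = inj₂ (2P∸1≤IIt , <⇒≤ IIt<It)

  IIt∉B₁ : ¬ InB₁ k (IIt k)
  IIt∉B₁ (inj₁ IIt≡0) = contradiction (≤-trans 1≤2P∸1 (subst (2 * P ∸ 1 ≤_) IIt≡0 2P∸1≤IIt)) λ ()
  IIt∉B₁ (inj₂ (Ib≤IIt , _)) = <-irrefl refl (subst (_≤ IIt k) Ib≡suc-IIt Ib≤IIt)

  Ib∈B₁ : InB₁ k (Ib k)
  Ib∈B₁ = inj₂ (≤-refl , Ib≤It)

  IIt→Ib : IsEdge k blue (IIt k) (Ib k)
  IIt→Ib = subst (IsEdge k blue (IIt k)) (sym Ib≡suc-IIt) (blueEdge (IIt k) 2P∸1≤IIt IIt<It)

  P₂-preserves-B₁ : ∀ m → InB₁ k m → InB₁ k (P₂ m)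
  P₂-preserves-B₁ .0 (inj₁ refl) = inj₁ refl
  P₂-preserves-B₁ m (inj₂ (Ib≤m , m≤It))
    with P₂-topQuarter p m (subst (_≤ m) Ib≡3P∸1 Ib≤m) (m≤pred[n]⇒suc[m]≤n {{m^n≢0 2 k}} m≤It)
  ... | inj₁ P₂m≡0 = inj₁ P₂m≡0
  ... | inj₂ 3P∸1≤P₂m = inj₂ (subst (_≤ P₂ m) (sym Ib≡3P∸1) 3P∸1≤P₂m , ≤-trans (P₂[m]≤m m) m≤It)

  blue-into-B₁ : ∀ m → m ≤ It k → ¬ InB₁ k m → InB₁ k (suc m) → m ≡ IIt k × suc m ≡ Ib k
  blue-into-B₁ m m≤It m∉B₁ (inj₂ (Ib≤sm , _)) = suc-injective (trans sm≡Ib Ib≡suc-IIt) , sm≡Ib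
    where
    m<Ib : m < Ib k
    m<Ib = ≰⇒> λ Ib≤m → m∉B₁ (inj₂ (Ib≤m , m≤It))
    sm≡Ib : suc m ≡ Ib k
    sm≡Ib = ≤-antisym m<Ib Ib≤sm

  only-edge-into-B₁ : ∀ c u v → IsEdge k c u v → ¬ InB₁ k u → InB₁ k v →
    c ≡ blue × u ≡ IIt k × v ≡ Ib k
  only-edge-into-B₁ .blue m .(suc m) (blueEdge m _ m<It) m∉B₁ sm∈B₁ =
    refl , blue-into-B₁ m (<⇒≤ m<It) m∉B₁ sm∈B₁
  only-edge-into-B₁ .red .(P₂ m) m (redEdge m _ _) P₂m∉B₁ m∈B₁ =
    contradiction (P₂-preserves-B₁ m m∈B₁) P₂m∉B₁

mainTheorem17 : (k : ℕ) → 4 ≤ k →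
    (IsEdge k blue (IIt k) (Ib k) × IsNode k (IIt k) × ¬ InB₁ k (IIt k) × InB₁ k (Ib k))
    × (∀ c u v → IsEdge k c u v → IsNode k u → ¬ InB₁ k u → InB₁ k v →
    (c ≡ blue × u ≡ IIt k × v ≡ Ib k))
mainTheorem17 (suc (suc p)) (s≤s (s≤s _)) =
  (IIt→Ib p , IIt-isNode p , IIt∉B₁ p , Ib∈B₁ p) ,
  λ c u v edge _ → only-edge-into-B₁ p c u v edge
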